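{- Let $\mathbf A$ be an integral FL${}_{\mathrm e}$-algebra, let $\delta\colon A\to A$ be an increasing map (i.e. $x\leq\delta(x)$ for all $x$), and let ${\Rightarrow}$ be a binary operation on $A$ with $(x\to y)\cdot(y\to\delta(x))\leq x{\Rightarrow} y\leq (x\to y)\wedge(y\to\delta(x))$ for all $x,y\in A$. Then $(\mathbf A,{\Rightarrow})$ is proto-connexive and ${\Rightarrow}$ is symmetric on $A$ (i.e. $x{\Rightarrow} y=y{\Rightarrow} x$ for all $x,y$) if and only if $\delta(x)=\neg\neg x$ for all $x\in A$ and $\mathbf A$ is a Boolean algebra (i.e. satisfies $x\cdot y=x\wedge y$ and $x\to y=\neg x\vee y$).
   Context: An FL${}_{\mathrm e}$-algebra is an algebra $\langle A,\wedge,\vee,\cdot,\to,0,1\rangle$ such that $\langle A,\wedge,\vee\rangle$ is a lattice (with order $\leq$), $\langle A,\cdot,1\rangle$ is a commutative monoid, $0$ is an arbitrary constant, and $x\cdot y\leq z\iff x\leq y\to z$; it is integral if $1$ is the greatest element. Write $\neg x:=x\to 0$. $(\mathbf A,{\Rightarrow})$ is proto-connexive if for all $x,y\in A$: $1\leq\neg(x{\Rightarrow}\neg x)$, $1\leq\neg(\neg x{\Rightarrow} x)$, $1\leq (x{\Rightarrow} y){\Rightarrow}\neg(x{\Rightarrow}\neg y)$, $1\leq (x{\Rightarrow}\neg y){\Rightarrow}\neg(x{\Rightarrow} y)$. -}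

module Defs where

open import Level using (Level; suc)
open import Relation.Binary.PropositionalEquality using (_≡_)
open import Data.Product using (_×_)
open import Function.Bundles using (_⇔_)

record FLe (a : Level) : Set (suc a) where
  infixr 6 _∧_
  infixr 5 _∨_
  infixl 7 _·_
  infixr 4 _⇒_
  infix 3 _≤_
  infix 9 ¬_
  field
    Carrier : Set a
    _∧_ _∨_ _·_ _⇒_ : Carrier → Carrier → Carrier
    𝟘 𝟙 : Carrier
    ∧-comm   : ∀ x y → x ∧ y ≡ y ∧ x
    ∨-comm   : ∀ x y → x ∨ y ≡ y ∨ x
    ∧-assoc  : ∀ x y z → (x ∧ y) ∧ z ≡ x ∧ (y ∧ z)
    ∨-assoc  : ∀ x y z → (x ∨ y) ∨ z ≡ x ∨ (y ∨ z)
    ∧-absorb : ∀ x y → x ∧ (x ∨ y) ≡ x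
    ∨-absorb : ∀ x y → x ∨ (x ∧ y) ≡ x
    ·-comm   : ∀ x y → x · y ≡ y · x
    ·-assoc  : ∀ x y z → (x · y) · z ≡ x · (y · z)
    ·-identityˡ : ∀ x → 𝟙 · x ≡ x

  _≤_ : Carrier → Carrier → Set a
  x ≤ y = x ∧ y ≡ x

  field
    residuation : ∀ x y z → (x · y ≤ z) ⇔ (x ≤ (y ⇒ z))

  ¬_ : Carrier → Carrier
  ¬ x = x ⇒ 𝟘

  Integral : Set a
  Integral = ∀ x → x ≤ 𝟙

  Boolean : Set a
  Boolean = (∀ x y → x · y ≡ x ∧ y) × (∀ x y → (x ⇒ y) ≡ (¬ x) ∨ y)

  ProtoConnexive : (Carrier → Carrier → Carrier) → Set a
  ProtoConnexive _⇛_ =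
    (∀ x → 𝟙 ≤ ¬ (x ⇛ (¬ x))) ×
    (∀ x → 𝟙 ≤ ¬ ((¬ x) ⇛ x)) ×
    (∀ x y → 𝟙 ≤ ((x ⇛ y) ⇛ (¬ (x ⇛ (¬ y))))) ×
    (∀ x y → 𝟙 ≤ ((x ⇛ (¬ y)) ⇛ (¬ (x ⇛ y))))

  Symmetric : (Carrier → Carrier → Carrier) → Set a
  Symmetric _⇛_ = ∀ x y → (x ⇛ y) ≡ (y ⇛ x)

-- Evaluating the bounds on ⇛ at 𝟙 gives x ⇛ 𝟙 = δ x and 𝟙 ⇛ x = x, so symmetry forces
-- δ = id, and then 𝟙 ≤ x ⇛ y only when x = y.  The last two proto-connexive axioms thus
-- become the identities x ⇛ ¬ y = ¬ (x ⇛ y) and x ⇛ y = ¬ (x ⇛ ¬ y), which at y = 𝟙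
-- give ¬ ¬ x = x; the first axiom then gives x ≤ x · x.  An integral FLe-algebra that is
-- idempotent and involutive is Boolean.  Conversely, in a Boolean algebra δ = id squeezes
-- ⇛ to the biconditional x ↔ y, which is symmetric and satisfies x ↔ ¬ y = ¬ (x ↔ y).
module Submission where

open import Defs
open import Level using (Level)
open import Algebra.Lattice.Bundles using (Lattice)
open import Algebra.Lattice.Properties.Lattice using (∨-∧-orderTheoreticLattice)
import Relation.Binary.Lattice.Bundles as OrderTheoretic
open import Relation.Binary.Bundles using (Poset)
import Relation.Binary.Reasoning.PartialOrder as PosetReasoning
open import Relation.Binary.PropositionalEquality
  using (_≡_; refl; sym; trans; cong; cong₂; subst; subst₂; isEquivalence)
open import Data.Product using (_×_; _,_)
open import Function.Bundles using (_⇔_; mk⇔; Equivalence)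

module LatticeOrder {a} (A : FLe a) where
  open FLe A

  lattice : Lattice a a
  lattice = record
    { _∨_ = _∨_
    ; _∧_ = _∧_
    ; isLattice = record
      { isEquivalence = isEquivalence
      ; ∨-comm = ∨-comm
      ; ∨-assoc = ∨-assoc
      ; ∨-cong = cong₂ _∨_
      ; ∧-comm = ∧-comm
      ; ∧-assoc = ∧-assoc
      ; ∧-cong = cong₂ _∧_
      ; absorptive = ∨-absorb , ∧-absorb
      }
    }

  -- The library orders a lattice by x ≡ x ∧ y, the symmetric form of x ≤ y.
  private module L = OrderTheoretic.Lattice (∨-∧-orderTheoreticLattice lattice)

  ≤-refl : ∀ {x} → x ≤ x
  ≤-refl = sym L.refl

  ≤-trans : ∀ {x y z} → x ≤ y → y ≤ z → x ≤ z
  ≤-trans p q = sym (L.trans (sym p) (sym q))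

  ≤-antisym : ∀ {x y} → x ≤ y → y ≤ x → x ≡ y
  ≤-antisym p q = L.antisym (sym p) (sym q)

  x∧y≤x : ∀ x y → x ∧ y ≤ x
  x∧y≤x x y = sym (L.x∧y≤x x y)

  x∧y≤y : ∀ x y → x ∧ y ≤ y
  x∧y≤y x y = sym (L.x∧y≤y x y)

  ∧-greatest : ∀ {x y z} → x ≤ y → x ≤ z → x ≤ y ∧ z
  ∧-greatest p q = sym (L.∧-greatest (sym p) (sym q))

  x≤x∨y : ∀ x y → x ≤ x ∨ y
  x≤x∨y x y = sym (L.x≤x∨y x y)

  y≤x∨y : ∀ x y → y ≤ x ∨ y
  y≤x∨y x y = sym (L.y≤x∨y x y)

  ∨-least : ∀ {x y z} → x ≤ z → y ≤ z → x ∨ y ≤ z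
  ∨-least p q = sym (L.∨-least (sym p) (sym q))

  ∧-idem : ∀ x → x ∧ x ≡ x
  ∧-idem x = ≤-refl

  poset : Poset a a a
  poset = record
    { isPartialOrder = record
      { isPreorder = record
        { isEquivalence = isEquivalence
        ; reflexive = λ { refl → ≤-refl }
        ; trans = ≤-trans
        }
      ; antisym = ≤-antisym
      }
    }

module Residuated {a} (A : FLe a) where
  open FLe A
  open LatticeOrder A public
  open PosetReasoning poset

  infixr 4 _↔_
  _↔_ : Carrier → Carrier → Carrier
  x ↔ y = (x ⇒ y) ∧ (y ⇒ x)

  residual : ∀ {x y z} → x · y ≤ z → x ≤ y ⇒ z
  residual {x} {y} {z} = Equivalence.to (residuation x y z)

  residual⁻ : ∀ {x y z} → x ≤ y ⇒ z → x · y ≤ z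
  residual⁻ {x} {y} {z} = Equivalence.from (residuation x y z)

  ⇒-eval : ∀ {x y} → (x ⇒ y) · x ≤ y
  ⇒-eval = residual⁻ ≤-refl

  ·-identityʳ : ∀ x → x · 𝟙 ≡ x
  ·-identityʳ x = trans (·-comm x 𝟙) (·-identityˡ x)

  ·-monoˡ-≤ : ∀ {x y} z → x ≤ y → x · z ≤ y · z
  ·-monoˡ-≤ z x≤y = residual⁻ (≤-trans x≤y (residual ≤-refl))

  ·-monoʳ-≤ : ∀ {x y} z → x ≤ y → z · x ≤ z · y
  ·-monoʳ-≤ {x} {y} z x≤y = subst₂ _≤_ (·-comm x z) (·-comm y z) (·-monoˡ-≤ z x≤y)

  ·-mono-≤ : ∀ {x y u v} → x ≤ y → u ≤ v → x · u ≤ y · v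
  ·-mono-≤ {y = y} {u = u} x≤y u≤v = ≤-trans (·-monoˡ-≤ u x≤y) (·-monoʳ-≤ y u≤v)

  ⇒-antitoneˡ : ∀ {x y} z → x ≤ y → y ⇒ z ≤ x ⇒ z
  ⇒-antitoneˡ {y = y} z x≤y = residual (≤-trans (·-monoʳ-≤ (y ⇒ z) x≤y) ⇒-eval)

  ¬-antitone : ∀ {x y} → x ≤ y → ¬ y ≤ ¬ x
  ¬-antitone = ⇒-antitoneˡ 𝟘

  x·¬x≤𝟘 : ∀ x → x · ¬ x ≤ 𝟘
  x·¬x≤𝟘 x = subst (_≤ 𝟘) (·-comm (¬ x) x) ⇒-eval

  ⇒-curry : ∀ x y z → ((x · y) ⇒ z) ≡ (x ⇒ y ⇒ z)
  ⇒-curry x y z = ≤-antisym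
    (residual (residual (subst (_≤ z) (sym (·-assoc _ x y)) ⇒-eval)))
    (residual (subst (_≤ z) (·-assoc _ x y) (residual⁻ (residual⁻ ≤-refl))))

  ¬-swap : ∀ x y → (x ⇒ ¬ y) ≡ (y ⇒ ¬ x)
  ¬-swap x y = begin-equality
    x ⇒ ¬ y      ≡⟨ ⇒-curry x y 𝟘 ⟨
    ¬ (x · y)    ≡⟨ cong ¬_ (·-comm x y) ⟩
    ¬ (y · x)    ≡⟨ ⇒-curry y x 𝟘 ⟩
    y ⇒ ¬ x      ∎

  contrapose-· : ∀ {u v w} → u · v ≤ w → ¬ w ≤ u ⇒ ¬ v
  contrapose-· {u} {v} {w} uv≤w = subst (¬ w ≤_) (⇒-curry u v 𝟘) (¬-antitone uv≤w)

  x≤¬¬x : ∀ x → x ≤ ¬ ¬ x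
  x≤¬¬x x = residual (x·¬x≤𝟘 x)

  ¬¬¬x≡¬x : ∀ x → ¬ ¬ ¬ x ≡ ¬ x
  ¬¬¬x≡¬x x = ≤-antisym (¬-antitone (x≤¬¬x x)) (x≤¬¬x (¬ x))

  ≤⇒𝟙≤⇒ : ∀ {x y} → x ≤ y → 𝟙 ≤ x ⇒ y
  ≤⇒𝟙≤⇒ {x} x≤y = residual (subst (_≤ _) (sym (·-identityˡ x)) x≤y)

  𝟙≤⇒⇒≤ : ∀ {x y} → 𝟙 ≤ x ⇒ y → x ≤ y
  𝟙≤⇒⇒≤ {x} 𝟙≤x⇒y = subst (_≤ _) (·-identityˡ x) (residual⁻ 𝟙≤x⇒y)

  𝟙⇒x≡x : ∀ x → (𝟙 ⇒ x) ≡ x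
  𝟙⇒x≡x x = ≤-antisym
    (subst (_≤ x) (·-identityʳ _) ⇒-eval)
    (residual (subst (_≤ x) (sym (·-identityʳ x)) ≤-refl))

  𝟙≤x↔x : ∀ x → 𝟙 ≤ x ↔ x
  𝟙≤x↔x x = ∧-greatest (≤⇒𝟙≤⇒ ≤-refl) (≤⇒𝟙≤⇒ ≤-refl)

  ↔-comm : ∀ x y → (x ↔ y) ≡ (y ↔ x)
  ↔-comm x y = ∧-comm (x ⇒ y) (y ⇒ x)

module Integral {a} (A : FLe a) (integral : FLe.Integral A) where
  open FLe A
  open Residuated A public
  open PosetReasoning poset

  x·y≤x : ∀ x y → x · y ≤ x
  x·y≤x x y = subst (x · y ≤_) (·-identityʳ x) (·-monoʳ-≤ x (integral y))

  x·y≤y : ∀ x y → x · y ≤ y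
  x·y≤y x y = subst (_≤ y) (·-comm y x) (x·y≤x y x)

  y≤x⇒y : ∀ {x y} → y ≤ x ⇒ y
  y≤x⇒y = residual (x·y≤x _ _)

  module Idempotent (·-idem : ∀ x → x · x ≡ x) where

    ≤-absurd : ∀ {a x} → a ≤ x → a ≤ ¬ x → a ≤ 𝟘
    ≤-absurd {a} {x} a≤x a≤¬x = begin
      a        ≡⟨ ·-idem a ⟨
      a · a    ≤⟨ ·-mono-≤ a≤x a≤¬x ⟩
      x · ¬ x  ≤⟨ x·¬x≤𝟘 x ⟩
      𝟘        ∎

    ≤-reductio : ∀ {a x y} → a ≤ x ⇒ y → a ≤ x ⇒ ¬ y → a ≤ ¬ x
    ≤-reductio a≤x⇒y a≤x⇒¬y = residual (≤-absurd (residual⁻ a≤x⇒y) (residual⁻ a≤x⇒¬y))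

    ·≡∧ : ∀ x y → x · y ≡ x ∧ y
    ·≡∧ x y = ≤-antisym (∧-greatest (x·y≤x x y) (x·y≤y x y)) (begin
      x ∧ y              ≡⟨ ·-idem (x ∧ y) ⟨
      (x ∧ y) · (x ∧ y)  ≤⟨ ·-mono-≤ (x∧y≤x x y) (x∧y≤y x y) ⟩
      x · y              ∎)

  module IdempotentInvolutive
    (·-idem : ∀ x → x · x ≡ x) (¬¬-involutive : ∀ x → ¬ ¬ x ≡ x) where
    open Idempotent ·-idem public

    𝟘≤x : ∀ x → 𝟘 ≤ x
    𝟘≤x x = subst₂ _≤_ (𝟙⇒x≡x 𝟘) (¬¬-involutive x) (¬-antitone (integral (¬ x)))

    ¬x≤x⇒y : ∀ {x y} → ¬ x ≤ x ⇒ y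
    ¬x≤x⇒y {x} {y} = residual (≤-trans ⇒-eval (𝟘≤x y))

    ⇒≡¬∨ : ∀ x y → (x ⇒ y) ≡ ¬ x ∨ y
    ⇒≡¬∨ x y = ≤-antisym ≤-¬∨ (∨-least ¬x≤x⇒y y≤x⇒y)
      where
      n = ¬ (¬ x ∨ y)
      n≤x : n ≤ x
      n≤x = subst (n ≤_) (¬¬-involutive x) (¬-antitone (x≤x∨y (¬ x) y))
      ≤-¬∨ : x ⇒ y ≤ ¬ x ∨ y
      ≤-¬∨ = subst (x ⇒ y ≤_) (¬¬-involutive _) (residual (≤-absurd
        (≤-trans (·-monoʳ-≤ (x ⇒ y) n≤x) ⇒-eval)
        (≤-trans (x·y≤y (x ⇒ y) n) (¬-antitone (y≤x∨y (¬ x) y)))))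

    boolean : Boolean
    boolean = ·≡∧ , ⇒≡¬∨

    ↔-¬ʳ : ∀ x y → (x ↔ ¬ y) ≡ ¬ (x ↔ y)
    ↔-¬ʳ x y = ≤-antisym (residual (≤-absurd M≤y M≤¬y)) (∧-greatest ¬W≤x⇒¬y ¬W≤¬y⇒x)
      where
      V = x ↔ ¬ y
      W = x ↔ y
      M = V · W
      M≤V : M ≤ V
      M≤V = x·y≤x V W
      M≤W : M ≤ W
      M≤W = x·y≤y V W
      M≤y : M ≤ y
      M≤y = subst (M ≤_) (¬¬-involutive y) (≤-reductio
        (≤-trans M≤V (x∧y≤y _ _))
        (subst (M ≤_) (trans (cong (x ⇒_) (sym (¬¬-involutive y))) (¬-swap x (¬ y)))
          (≤-trans M≤W (x∧y≤x _ _))))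
      M≤¬y : M ≤ ¬ y
      M≤¬y = ≤-reductio
        (≤-trans M≤W (x∧y≤y _ _))
        (subst (M ≤_) (¬-swap x y) (≤-trans M≤V (x∧y≤x _ _)))
      ¬W≤x⇒¬y : ¬ W ≤ x ⇒ ¬ y
      ¬W≤x⇒¬y = contrapose-· (∧-greatest
        (≤-trans (x·y≤y x y) y≤x⇒y)
        (≤-trans (x·y≤x x y) y≤x⇒y))
      ¬W≤¬y⇒x : ¬ W ≤ ¬ y ⇒ x
      ¬W≤¬y⇒x = begin
        ¬ W            ≤⟨ contrapose-· (∧-greatest
                            (≤-trans (x·y≤x (¬ x) (¬ y)) ¬x≤x⇒y)
                            (≤-trans (x·y≤y (¬ x) (¬ y)) ¬x≤x⇒y)) ⟩
        ¬ x ⇒ ¬ ¬ y    ≡⟨ ¬-swap (¬ x) (¬ y) ⟩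
        ¬ y ⇒ ¬ ¬ x    ≡⟨ cong (¬ y ⇒_) (¬¬-involutive x) ⟩
        ¬ y ⇒ x        ∎

  Boolean⇒idempotent : Boolean → ∀ x → x · x ≡ x
  Boolean⇒idempotent (·≡∧ , _) x = trans (·≡∧ x x) (∧-idem x)

  Boolean⇒involutive : Boolean → ∀ x → ¬ ¬ x ≡ x
  Boolean⇒involutive (_ , ⇒≡¬∨) x = ≤-antisym (𝟙≤⇒⇒≤ 𝟙≤¬¬x⇒x) (x≤¬¬x x)
    where
    𝟙≤¬¬x⇒x : 𝟙 ≤ ¬ ¬ x ⇒ x
    𝟙≤¬¬x⇒x = subst (𝟙 ≤_) (sym (begin-equality
      ¬ ¬ x ⇒ x      ≡⟨ ⇒≡¬∨ (¬ ¬ x) x ⟩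
      ¬ ¬ ¬ x ∨ x    ≡⟨ cong (_∨ x) (¬¬¬x≡¬x x) ⟩
      ¬ x ∨ x        ≡⟨ ⇒≡¬∨ x x ⟨
      x ⇒ x          ∎)) (≤⇒𝟙≤⇒ ≤-refl)

  module Bounded
    (δ : Carrier → Carrier) (x≤δx : ∀ x → x ≤ δ x)
    (_⇛_ : Carrier → Carrier → Carrier)
    (lower : ∀ x y → ((x ⇒ y) · (y ⇒ δ x)) ≤ (x ⇛ y))
    (upper : ∀ x y → (x ⇛ y) ≤ ((x ⇒ y) ∧ (y ⇒ δ x))) where

    x⇛𝟙≡δx : ∀ x → x ⇛ 𝟙 ≡ δ x
    x⇛𝟙≡δx x = ≤-antisym
      (begin
        x ⇛ 𝟙                  ≤⟨ upper x 𝟙 ⟩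
        (x ⇒ 𝟙) ∧ (𝟙 ⇒ δ x)    ≤⟨ x∧y≤y _ _ ⟩
        𝟙 ⇒ δ x                ≡⟨ 𝟙⇒x≡x (δ x) ⟩
        δ x                    ∎)
      (begin
        δ x                    ≡⟨ 𝟙⇒x≡x (δ x) ⟨
        𝟙 ⇒ δ x                ≡⟨ ·-identityˡ _ ⟨
        𝟙 · (𝟙 ⇒ δ x)          ≤⟨ ·-monoˡ-≤ _ (≤⇒𝟙≤⇒ (integral x)) ⟩
        (x ⇒ 𝟙) · (𝟙 ⇒ δ x)    ≤⟨ lower x 𝟙 ⟩
        x ⇛ 𝟙                  ∎)

    𝟙⇛x≡x : ∀ x → 𝟙 ⇛ x ≡ x
    𝟙⇛x≡x x = ≤-antisym
      (begin
        𝟙 ⇛ x                  ≤⟨ upper 𝟙 x ⟩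
        (𝟙 ⇒ x) ∧ (x ⇒ δ 𝟙)    ≤⟨ x∧y≤x _ _ ⟩
        𝟙 ⇒ x                  ≡⟨ 𝟙⇒x≡x x ⟩
        x                      ∎)
      (begin
        x                      ≡⟨ ·-identityʳ x ⟨
        x · 𝟙                  ≡⟨ cong (_· 𝟙) (𝟙⇒x≡x x) ⟨
        (𝟙 ⇒ x) · 𝟙            ≤⟨ ·-monoʳ-≤ _ (≤⇒𝟙≤⇒ (≤-trans (integral x) (x≤δx 𝟙))) ⟩
        (𝟙 ⇒ x) · (x ⇒ δ 𝟙)    ≤⟨ lower 𝟙 x ⟩
        𝟙 ⇛ x                  ∎)

    Symmetric⇒δ≡id : Symmetric _⇛_ → ∀ x → δ x ≡ x
    Symmetric⇒δ≡id ⇛-sym x = begin-equality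
      δ x      ≡⟨ x⇛𝟙≡δx x ⟨
      x ⇛ 𝟙    ≡⟨ ⇛-sym x 𝟙 ⟩
      𝟙 ⇛ x    ≡⟨ 𝟙⇛x≡x x ⟩
      x        ∎

    module ConnexiveSymmetric (connexive : ProtoConnexive _⇛_) (⇛-sym : Symmetric _⇛_) where
      δ≡id : ∀ x → δ x ≡ x
      δ≡id = Symmetric⇒δ≡id ⇛-sym

      𝟙≤x⇛y⇒x≡y : ∀ {x y} → 𝟙 ≤ x ⇛ y → x ≡ y
      𝟙≤x⇛y⇒x≡y {x} {y} 𝟙≤x⇛y = ≤-antisym
        (𝟙≤⇒⇒≤ (≤-trans 𝟙≤x⇛y (≤-trans (upper x y) (x∧y≤x _ _))))
        (subst (y ≤_) (δ≡id x) (𝟙≤⇒⇒≤ (≤-trans 𝟙≤x⇛y (≤-trans (upper x y) (x∧y≤y _ _)))))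

      x⇛y≡¬[x⇛¬y] : ∀ x y → x ⇛ y ≡ ¬ (x ⇛ (¬ y))
      x⇛y≡¬[x⇛¬y] x y = 𝟙≤x⇛y⇒x≡y (let _ , _ , third , _ = connexive in third x y)

      x⇛¬y≡¬[x⇛y] : ∀ x y → x ⇛ (¬ y) ≡ ¬ (x ⇛ y)
      x⇛¬y≡¬[x⇛y] x y = 𝟙≤x⇛y⇒x≡y (let _ , _ , _ , fourth = connexive in fourth x y)

      ¬¬-involutive : ∀ x → ¬ ¬ x ≡ x
      ¬¬-involutive x = begin-equality
        ¬ ¬ x              ≡⟨ cong (λ t → ¬ ¬ t) (trans (x⇛𝟙≡δx x) (δ≡id x)) ⟨
        ¬ ¬ (x ⇛ 𝟙)        ≡⟨ cong ¬_ (x⇛¬y≡¬[x⇛y] x 𝟙) ⟨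
        ¬ (x ⇛ (¬ 𝟙))      ≡⟨ x⇛y≡¬[x⇛¬y] x 𝟙 ⟨
        x ⇛ 𝟙              ≡⟨ trans (x⇛𝟙≡δx x) (δ≡id x) ⟩
        x                  ∎

      ·-idem : ∀ x → x · x ≡ x
      ·-idem x = ≤-antisym (x·y≤x x x) (begin
        x                  ≤⟨ y≤x⇒y ⟩
        ¬ x ⇒ x            ≤⟨ residual (subst (_≤ 𝟘) (·-comm _ _) x⇒¬x·¬x⇒x≤𝟘) ⟩
        ¬ (x ⇒ ¬ x)        ≡⟨ cong ¬_ (⇒-curry x x 𝟘) ⟨
        ¬ ¬ (x · x)        ≡⟨ ¬¬-involutive (x · x) ⟩
        x · x              ∎)
        where
        x⇒¬x·¬x⇒x≤𝟘 : (x ⇒ ¬ x) · (¬ x ⇒ x) ≤ 𝟘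
        x⇒¬x·¬x⇒x≤𝟘 = begin
          (x ⇒ ¬ x) · (¬ x ⇒ x)      ≡⟨ cong (λ t → (x ⇒ ¬ x) · (¬ x ⇒ t)) (δ≡id x) ⟨
          (x ⇒ ¬ x) · (¬ x ⇒ δ x)    ≤⟨ lower x (¬ x) ⟩
          x ⇛ (¬ x)                  ≤⟨ 𝟙≤⇒⇒≤ (let first , _ = connexive in first x) ⟩
          𝟘                          ∎

    module BooleanDoubleNegation (δ≡¬¬ : ∀ x → δ x ≡ ¬ ¬ x) (isBoolean : Boolean) where
      ¬¬-involutive : ∀ x → ¬ ¬ x ≡ x
      ¬¬-involutive = Boolean⇒involutive isBoolean

      open IdempotentInvolutive (Boolean⇒idempotent isBoolean) ¬¬-involutive

      x⇛y≡x↔y : ∀ x y → x ⇛ y ≡ (x ↔ y)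
      x⇛y≡x↔y x y = subst (λ t → x ⇛ y ≡ (x ⇒ y) ∧ (y ⇒ t)) δx≡x (≤-antisym (upper x y)
        (subst (_≤ x ⇛ y) (·≡∧ _ _) (lower x y)))
        where
        δx≡x : δ x ≡ x
        δx≡x = trans (δ≡¬¬ x) (¬¬-involutive x)

      ⇛-symmetric : Symmetric _⇛_
      ⇛-symmetric x y = begin-equality
        x ⇛ y    ≡⟨ x⇛y≡x↔y x y ⟩
        x ↔ y    ≡⟨ ↔-comm x y ⟩
        y ↔ x    ≡⟨ x⇛y≡x↔y y x ⟨
        y ⇛ x    ∎

      x⇛¬y≡¬[x⇛y] : ∀ x y → x ⇛ (¬ y) ≡ ¬ (x ⇛ y)
      x⇛¬y≡¬[x⇛y] x y = begin-equality
        x ⇛ (¬ y)    ≡⟨ x⇛y≡x↔y x (¬ y) ⟩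
        x ↔ ¬ y      ≡⟨ ↔-¬ʳ x y ⟩
        ¬ (x ↔ y)    ≡⟨ cong ¬_ (x⇛y≡x↔y x y) ⟨
        ¬ (x ⇛ y)    ∎

      𝟙≤x⇛x : ∀ x → 𝟙 ≤ x ⇛ x
      𝟙≤x⇛x x = subst (𝟙 ≤_) (sym (x⇛y≡x↔y x x)) (𝟙≤x↔x x)

      ⇛-protoConnexive : ProtoConnexive _⇛_
      ⇛-protoConnexive = first , second , third , fourth
        where
        first : ∀ x → 𝟙 ≤ ¬ (x ⇛ (¬ x))
        first x = subst (𝟙 ≤_) (sym (trans (cong ¬_ (x⇛¬y≡¬[x⇛y] x x)) (¬¬-involutive _)))
          (𝟙≤x⇛x x)
        second : ∀ x → 𝟙 ≤ ¬ ((¬ x) ⇛ x)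
        second x = subst (λ t → 𝟙 ≤ ¬ t) (⇛-symmetric x (¬ x)) (first x)
        third : ∀ x y → 𝟙 ≤ (x ⇛ y) ⇛ (¬ (x ⇛ (¬ y)))
        third x y = subst (λ t → 𝟙 ≤ (x ⇛ y) ⇛ t)
          (sym (trans (cong ¬_ (x⇛¬y≡¬[x⇛y] x y)) (¬¬-involutive _))) (𝟙≤x⇛x _)
        fourth : ∀ x y → 𝟙 ≤ (x ⇛ (¬ y)) ⇛ (¬ (x ⇛ y))
        fourth x y = subst (λ t → 𝟙 ≤ t ⇛ (¬ (x ⇛ y))) (sym (x⇛¬y≡¬[x⇛y] x y)) (𝟙≤x⇛x _)

theorem3p24 : ∀ {a : Level} (A : FLe a) → let open FLe A in
    Integral →
    (δ : Carrier → Carrier) → (∀ x → x ≤ δ x) →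
    (_⇛_ : Carrier → Carrier → Carrier) →
    (∀ x y → ((x ⇒ y) · (y ⇒ δ x)) ≤ (x ⇛ y)) →
    (∀ x y → (x ⇛ y) ≤ ((x ⇒ y) ∧ (y ⇒ δ x))) →
    ((ProtoConnexive _⇛_ × Symmetric _⇛_)
      ⇔ ((∀ x → δ x ≡ ¬ (¬ x)) × Boolean))
theorem3p24 A integral δ x≤δx _⇛_ lower upper = mk⇔ forward backward
  where
  open FLe A
  open Integral A integral
  open Bounded δ x≤δx _⇛_ lower upper

  forward : ProtoConnexive _⇛_ × Symmetric _⇛_ → (∀ x → δ x ≡ ¬ ¬ x) × Boolean
  forward (connexive , ⇛-sym) =
    (λ x → trans (δ≡id x) (sym (¬¬-involutive x))) , boolean
    where
    open ConnexiveSymmetric connexive ⇛-sym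
    open IdempotentInvolutive ·-idem ¬¬-involutive using (boolean)

  backward : (∀ x → δ x ≡ ¬ ¬ x) × Boolean → ProtoConnexive _⇛_ × Symmetric _⇛_
  backward (δ≡¬¬ , isBoolean) = ⇛-protoConnexive , ⇛-symmetric
    where open BooleanDoubleNegation δ≡¬¬ isBoolean
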